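{- Let $G$ be a connected graph. If $G$ has a dominating $K_p$ with $p\ge 4$, then $G$ has exactly one perfect edge dominating set, namely the trivial one $E(G)$.
   Context: Graphs are finite, simple and undirected. An edge dominates itself and every edge sharing an endpoint with it. A set $P\subseteq E(G)$ is a perfect edge dominating set if every edge of $E(G)\setminus P$ is dominated by exactly one edge of $P$; $E(G)$ is the trivial one. A dominating $K_p$ is a set of $p$ pairwise adjacent vertices such that every other vertex has a neighbour in it. -}

module Defs where

open import Level using (0ℓ)
open import Data.Nat using (ℕ; _≥_)
open import Data.Fin using (Fin)
open import Data.Product using (Σ; ∃; ∃-syntax; _×_; _,_)
open import Data.Sum using (_⊎_)
open import Relation.Nullary using (¬_; Dec)
open import Relation.Binary using (Decidable)
open import Relation.Binary.PropositionalEquality using (_≡_; _≢_)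
open import Relation.Binary.Construct.Closure.ReflexiveTransitive using (Star)
open import Function.Definitions using (Injective)

record Graph (n : ℕ) : Set₁ where
  field
    Adj    : Fin n → Fin n → Set
    adj?   : Decidable Adj
    irrefl : ∀ u → ¬ Adj u u
    sym    : ∀ {u v} → Adj u v → Adj v u

module _ {n : ℕ} (G : Graph n) where
  open Graph G

  Connected : Set
  Connected = ∀ u v → Star Adj u v

  -- A set of edges of G, given as a (decidable) symmetric relation on
  -- vertices contained in the adjacency relation; the edge {u,v} belongs
  -- to the set iff P u v (equivalently P v u).
  record EdgeSet : Set₁ where
    field
      _∈E_   : Fin n → Fin n → Set
      dec    : Decidable _∈E_
      sub    : ∀ {u v} → u ∈E v → Adj u v
      symm   : ∀ {u v} → u ∈E v → v ∈E u

  allEdges : EdgeSet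
  allEdges = record { _∈E_ = Adj ; dec = adj? ; sub = λ p → p ; symm = sym }

SameEdge : ∀ {n} → Fin n → Fin n → Fin n → Fin n → Set
SameEdge a b c d = (a ≡ c × b ≡ d) ⊎ (a ≡ d × b ≡ c)

Dominates : ∀ {n} → Fin n → Fin n → Fin n → Fin n → Set
Dominates a b c d = (a ≡ c ⊎ a ≡ d) ⊎ (b ≡ c ⊎ b ≡ d)

IsPerfectEdgeDominatingSet : ∀ {n} (G : Graph n) → EdgeSet G → Set
IsPerfectEdgeDominatingSet {n} G P =
  ∀ c d → Adj c d → ¬ (c ∈E d) →
    (∃[ a ] ∃[ b ] (a ∈E b × Dominates a b c d))
    × (∀ a b a' b' → a ∈E b → Dominates a b c d
                   → a' ∈E b' → Dominates a' b' c d → SameEdge a b a' b')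
  where open Graph G
        open EdgeSet P

HasDominatingClique : ∀ {n} (G : Graph n) (p : ℕ) → Set
HasDominatingClique {n} G p =
  Σ (Fin p → Fin n) λ f →
    Injective _≡_ _≡_ f
    × (∀ i j → i ≢ j → Adj (f i) (f j))
    × (∀ v → (∀ i → v ≢ f i) → ∃[ i ] Adj v (f i))
  where open Graph G

module Submission where

open import Defs
open import Data.Nat using (ℕ; _+_; _≥_; suc; s≤s)
open import Data.Product using (_×_; _,_; proj₁; proj₂; ∃-syntax)
open import Data.Sum using (_⊎_; inj₁; inj₂)
open import Data.Empty using (⊥; ⊥-elim)
open import Data.Fin using (Fin; zero; suc; _≟_)
open import Data.Fin.Properties using (any?)
open import Data.List using ([]; _∷_)
open import Data.List.Relation.Unary.AllPairs using ([]; _∷_)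
open import Data.List.Relation.Unary.All using ([]; _∷_)
open import Data.List.Relation.Unary.Unique.Propositional using (Unique)
open import Relation.Nullary using (¬_; yes; no)
open import Relation.Binary.PropositionalEquality using (_≡_; _≢_; refl)

-- Call a vertex covered when it lies on an edge of P. Perfectness forces every
-- non-P edge to have exactly one covered end, and that end has a unique
-- P-neighbour. So adjacent covered vertices span a P-edge, and a vertex with two
-- P-neighbours has all its edges in P. In a K₄ an uncovered vertex would see three
-- covered neighbours, pairwise joined by P-edges; one of them then has two
-- P-neighbours and hence a P-edge to it. Thus the vertices of the dominating
-- clique are covered and have two P-neighbours each, every other vertex gets a
-- P-edge to the clique, all vertices are covered, and so every edge lies in P.

three-others : ∀ {m} (i : Fin (4 + m)) → ∃[ j ] ∃[ k ] ∃[ l ] Unique (i ∷ j ∷ k ∷ l ∷ [])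
three-others zero                      = suc zero , suc (suc zero) , suc (suc (suc zero)) ,
  ((λ ()) ∷ (λ ()) ∷ (λ ()) ∷ []) ∷ ((λ ()) ∷ (λ ()) ∷ []) ∷ ((λ ()) ∷ []) ∷ [] ∷ []
three-others (suc zero)                = zero , suc (suc zero) , suc (suc (suc zero)) ,
  ((λ ()) ∷ (λ ()) ∷ (λ ()) ∷ []) ∷ ((λ ()) ∷ (λ ()) ∷ []) ∷ ((λ ()) ∷ []) ∷ [] ∷ []
three-others (suc (suc zero))          = zero , suc zero , suc (suc (suc zero)) ,
  ((λ ()) ∷ (λ ()) ∷ (λ ()) ∷ []) ∷ ((λ ()) ∷ (λ ()) ∷ []) ∷ ((λ ()) ∷ []) ∷ [] ∷ []
three-others (suc (suc (suc zero)))    = zero , suc zero , suc (suc zero) ,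
  ((λ ()) ∷ (λ ()) ∷ (λ ()) ∷ []) ∷ ((λ ()) ∷ (λ ()) ∷ []) ∷ ((λ ()) ∷ []) ∷ [] ∷ []
three-others (suc (suc (suc (suc _)))) = zero , suc zero , suc (suc zero) ,
  ((λ ()) ∷ (λ ()) ∷ (λ ()) ∷ []) ∷ ((λ ()) ∷ (λ ()) ∷ []) ∷ ((λ ()) ∷ []) ∷ [] ∷ []

allEdges-isPerfect : ∀ {n} (G : Graph n) → IsPerfectEdgeDominatingSet G (allEdges G)
allEdges-isPerfect G c d cd c∉d = ⊥-elim (c∉d cd)

module PerfectEdgeDominatingSet {n : ℕ} (G : Graph n) (P : EdgeSet G)
                                (perfect : IsPerfectEdgeDominatingSet G P) where
  open Graph G
  open EdgeSet P

  Covered : Fin n → Set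
  Covered u = ∃[ x ] u ∈E x

  Saturated : Fin n → Set
  Saturated u = ∃[ x ] ∃[ y ] (x ≢ y × u ∈E x × u ∈E y)

  adj⇒≢ : ∀ {u v} → Adj u v → u ≢ v
  adj⇒≢ {u} uv refl = irrefl u uv

  edge-has-covered-end : ∀ {u v} → Adj u v → Covered u ⊎ Covered v
  edge-has-covered-end {u} {v} uv with dec u v
  ... | yes u∈v = inj₁ (v , u∈v)
  ... | no u∉v with proj₁ (perfect u v uv u∉v)
  ... | _ , y , x∈y , inj₁ (inj₁ refl) = inj₁ (y , x∈y)
  ... | _ , y , x∈y , inj₁ (inj₂ refl) = inj₂ (y , x∈y)
  ... | x , _ , x∈y , inj₂ (inj₁ refl) = inj₁ (x , symm x∈y)
  ... | x , _ , x∈y , inj₂ (inj₂ refl) = inj₂ (x , symm x∈y)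

  non-edge-not-covered-at-both-ends : ∀ {u v x y} → Adj u v → ¬ u ∈E v → u ∈E x → v ∈E y → ⊥
  non-edge-not-covered-at-both-ends {u} {v} {x} {y} uv u∉v u∈x v∈y
    with proj₂ (perfect u v uv u∉v) u x v y u∈x (inj₁ (inj₁ refl)) v∈y (inj₁ (inj₂ refl))
  ... | inj₁ (u≡v , _)    = adj⇒≢ uv u≡v
  ... | inj₂ (refl , refl) = u∉v u∈x

  P-neighbour-unique : ∀ {u v x y} → Adj u v → ¬ u ∈E v → u ∈E x → u ∈E y → x ≡ y
  P-neighbour-unique {u} {v} {x} {y} uv u∉v u∈x u∈y
    with proj₂ (perfect u v uv u∉v) u x u y u∈x (inj₁ (inj₁ refl)) u∈y (inj₁ (inj₁ refl))
  ... | inj₁ (_ , x≡y)    = x≡y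
  ... | inj₂ (refl , refl) = refl

  covered-adjacent : ∀ {u v} → Covered u → Covered v → Adj u v → u ∈E v
  covered-adjacent {u} {v} (_ , u∈x) (_ , v∈y) uv with dec u v
  ... | yes u∈v = u∈v
  ... | no u∉v  = ⊥-elim (non-edge-not-covered-at-both-ends uv u∉v u∈x v∈y)

  saturated-edge : ∀ {u w} → Saturated u → Adj u w → u ∈E w
  saturated-edge {u} {w} (_ , _ , x≢y , u∈x , u∈y) uw with dec u w
  ... | yes u∈w = u∈w
  ... | no u∉w  = ⊥-elim (x≢y (P-neighbour-unique uw u∉w u∈x u∈y))

  covered-triangle-saturated : ∀ {x y z} → Covered x → Covered y → Covered z
                             → Adj x y → Adj x z → y ≢ z → Saturated x
  covered-triangle-saturated {y = y} {z} x-covered y-covered z-covered xy xz y≢z =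
    y , z , y≢z , covered-adjacent x-covered y-covered xy , covered-adjacent x-covered z-covered xz

  K₄-vertex-covered : ∀ {c x y z} → Adj c x → Adj c y → Adj c z
                    → Adj x y → Adj x z → y ≢ z → Covered c
  K₄-vertex-covered cx cy cz xy xz y≢z
    with edge-has-covered-end cx | edge-has-covered-end cy | edge-has-covered-end cz
  ... | inj₁ c-covered | _             | _             = c-covered
  ... | _             | inj₁ c-covered | _             = c-covered
  ... | _             | _             | inj₁ c-covered = c-covered
  ... | inj₂ x-covered | inj₂ y-covered | inj₂ z-covered =
    _ , symm (saturated-edge (covered-triangle-saturated x-covered y-covered z-covered xy xz y≢z) (sym cx))

  module DominatingClique {m : ℕ} (f : Fin (4 + m) → Fin n)
                          (clique : ∀ i j → i ≢ j → Adj (f i) (f j))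
                          (dominating : ∀ v → (∀ i → v ≢ f i) → ∃[ i ] Adj v (f i)) where

    clique-vertex-covered : ∀ i → Covered (f i)
    clique-vertex-covered i with three-others i
    ... | j , k , l , (i≢j ∷ i≢k ∷ i≢l ∷ []) ∷ (j≢k ∷ j≢l ∷ []) ∷ (k≢l ∷ []) ∷ [] ∷ [] =
      K₄-vertex-covered (clique i j i≢j) (clique i k i≢k) (clique i l i≢l)
                        (clique j k j≢k) (clique j l j≢l) (adj⇒≢ (clique k l k≢l))

    clique-vertex-saturated : ∀ i → Saturated (f i)
    clique-vertex-saturated i with three-others i
    ... | j , k , _ , (i≢j ∷ i≢k ∷ _ ∷ []) ∷ (j≢k ∷ _ ∷ []) ∷ _ ∷ [] ∷ [] =
      covered-triangle-saturated (clique-vertex-covered i) (clique-vertex-covered j)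
                                 (clique-vertex-covered k) (clique i j i≢j) (clique i k i≢k)
                                 (adj⇒≢ (clique j k j≢k))

    every-vertex-covered : ∀ v → Covered v
    every-vertex-covered v with any? (λ i → v ≟ f i)
    ... | yes (i , refl) = clique-vertex-covered i
    ... | no v∉f with dominating v (λ i v≡fi → v∉f (i , v≡fi))
    ... | i , v~fi = f i , symm (saturated-edge (clique-vertex-saturated i) (sym v~fi))

    every-edge-in-P : ∀ u v → Adj u v → u ∈E v
    every-edge-in-P u v = covered-adjacent (every-vertex-covered u) (every-vertex-covered v)

corollary20 : ∀ {n} (G : Graph n) (p : ℕ) → Connected G → p ≥ 4 → HasDominatingClique G p
              → IsPerfectEdgeDominatingSet G (allEdges G)
                × (∀ (P : EdgeSet G) → IsPerfectEdgeDominatingSet G P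
                   → ∀ u v → Graph.Adj G u v → EdgeSet._∈E_ P u v)
corollary20 G .(suc (suc (suc (suc _)))) _ (s≤s (s≤s (s≤s (s≤s _)))) (f , _ , clique , dominating) =
  allEdges-isPerfect G ,
  λ P perfect → PerfectEdgeDominatingSet.DominatingClique.every-edge-in-P G P perfect f clique dominating
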